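{- Let $V^{\natural}$, $\varphi=\{\varphi_1,\dots,\varphi_n\}$, $b_i,b_i'$, $V^{\sharp}$ be as follows: $V^{\natural}$ is a finite set of boolean and integer variables; $\varphi$ is a finite set of predicates over integer variables of $V^{\natural}$ with variable set $V(\varphi)$; $b_1,\dots,b_n$ are fresh boolean variables and $V^{\sharp}=(V^{\natural}\cup\{b_1,\dots,b_n\})\setminus V(\varphi)$. Define $\gamma(s^{\sharp})=s^{\sharp}[\bar\varphi/\bar b]$ for sets of abstract states, and for a concrete transition relation $r^{\natural}$ $$\alpha^{\tau}(r^{\natural})=\exists V(\varphi).\exists V(\varphi').\Big(r^{\natural}\wedge CS\wedge\bigwedge_{i=1}^{n}(\varphi_i\iff b_i)\wedge\bigwedge_{i=1}^{n}(\varphi_i'\iff b_i')\Big),\quad CS=\bigwedge_{i=1}^{n}\Big(\big(\bigwedge_{v\in V(\varphi_i)} v'=v\big)\implies(b_i'\iff b_i)\Big).$$ Then for every concrete transition relation $r^{\natural}$ and every set of abstract states $s^{\sharp}$, $$post[r^{\natural}](\gamma(s^{\sharp}))\subseteq\gamma\big(post[\alpha^{\tau}(r^{\natural})](s^{\sharp})\big).$$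
   Context: For a transition relation $R$ and a set of states $A$, $post[R](A)=\{b\mid a\in A\wedge(a,b)\in R\}$. Primed predicates $\varphi_i'$ and variables $V(\varphi')$ are obtained by priming all variables. Sets of states/transitions are identified with formulas over the (current, resp. current and next) state variables. -}

module Defs where

open import Data.Bool using (Bool; true; false; T; not; _∨_)
open import Data.Fin using (Fin)
open import Data.Integer using (ℤ)
open import Data.Nat using (ℕ)
open import Data.Product using (Σ; ∃; _×_; _,_)
open import Relation.Binary.PropositionalEquality using (_≡_)

anyFin : (n : ℕ) → (Fin n → Bool) → Bool
anyFin ℕ.zero f = false
anyFin (ℕ.suc n) f = f Fin.zero ∨ anyFin n (λ i → f (Fin.suc i))

-- Concrete variables V♮: nb boolean variables and ni integer variables.
-- A concrete state is a valuation of V♮.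
record CState (nb ni : ℕ) : Set where
  constructor cst
  field
    bv : Fin nb → Bool
    iv : Fin ni → ℤ
open CState public

-- A predicate over the integer variables of V♮: its variable set
-- V(φ_i) (as a characteristic function), its meaning, and the fact that
-- its meaning only depends on the variables in V(φ_i).
record Pred (ni : ℕ) : Set where
  field
    vars : Fin ni → Bool
    eval : (Fin ni → ℤ) → Bool
    depends : (ι ι' : Fin ni → ℤ) →
              ((x : Fin ni) → T (vars x) → ι x ≡ ι' x) → eval ι ≡ eval ι'
open Pred public

module Abstraction {nb ni n : ℕ} (φ : Fin n → Pred ni) where

  inV : Fin ni → Bool
  inV x = anyFin n (λ i → vars (φ i) x)

  -- Abstract state: valuation of V♯ = (V♮ ∪ {b₁..bₙ}) ∖ V(φ):
  -- all boolean vars, the integer vars not in V(φ), and b₁..bₙ.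
  record AState : Set where
    constructor ast
    field
      abv : Fin nb → Bool
      aiv : (x : Fin ni) → T (not (inV x)) → ℤ
      bs  : Fin n → Bool
  open AState public

  ⟦_⟧ : Fin n → CState nb ni → Bool
  ⟦ i ⟧ σ = eval (φ i) (iv σ)

  Agree : CState nb ni → AState → Set
  Agree σ a = ((x : Fin nb) → bv σ x ≡ abv a x)
            × ((x : Fin ni) (p : T (not (inV x))) → iv σ x ≡ aiv a x p)

  γ : (AState → Set) → CState nb ni → Set
  γ s σ = s (ast (bv σ) (λ x _ → iv σ x) (λ i → ⟦ i ⟧ σ))

  CS : CState nb ni → CState nb ni → AState → AState → Set
  CS σ σ' a a' = (i : Fin n) →
    ((v : Fin ni) → T (vars (φ i) v) → iv σ' v ≡ iv σ v) → bs a' i ≡ bs a i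

  -- α^τ(r♮) = ∃V(φ).∃V(φ'). (r♮ ∧ CS ∧ ⋀(φᵢ ⇔ bᵢ) ∧ ⋀(φᵢ' ⇔ bᵢ'))
  -- Existential quantification over V(φ), V(φ') = existence of concrete
  -- valuations σ, σ' agreeing with a, a' outside V(φ).
  αᵗ : (CState nb ni → CState nb ni → Set) → AState → AState → Set
  αᵗ r a a' = Σ (CState nb ni) λ σ → Σ (CState nb ni) λ σ' →
    Agree σ a × Agree σ' a' × r σ σ' × CS σ σ' a a'
    × ((i : Fin n) → ⟦ i ⟧ σ ≡ bs a i)
    × ((i : Fin n) → ⟦ i ⟧ σ' ≡ bs a' i)

post : {S : Set} → (S → S → Set) → (S → Set) → S → Set
post {S} R A b = Σ S λ a → A a × R a b

_⊆_ : {S : Set} → (S → Set) → (S → Set) → Set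
A ⊆ B = ∀ x → A x → B x

module Submission where

-- The concrete successor σ' of a state σ ∈ γ(s♯) is abstracted by the
-- canonical abstract state of σ', which keeps the variables outside V(φ)
-- and sets bᵢ := φᵢ(σ'). The pair (σ, σ') itself witnesses the
-- existential quantifiers of αᵗ; the only non-trivial conjunct is CS,
-- which holds because each φᵢ depends only on the variables of V(φᵢ).

open import Defs
open import Data.Fin using (Fin)
open import Data.Nat using (ℕ)
open import Data.Product using (_,_)
open import Relation.Binary.PropositionalEquality using (refl)

module _ {nb ni n : ℕ} (φ : Fin n → Pred ni) where
  open Abstraction {nb} {ni} {n} φ

  abstraction : CState nb ni → AState
  abstraction σ = ast (bv σ) (λ x _ → iv σ x) (λ i → ⟦ i ⟧ σ)

  agree-abstraction : (σ : CState nb ni) → Agree σ (abstraction σ)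
  agree-abstraction σ = (λ _ → refl) , (λ _ _ → refl)

  CS-abstraction : (σ σ' : CState nb ni) →
                   CS σ σ' (abstraction σ) (abstraction σ')
  CS-abstraction σ σ' i unchanged = depends (φ i) (iv σ') (iv σ) unchanged

  αᵗ-abstraction : (r : CState nb ni → CState nb ni → Set)
                   {σ σ' : CState nb ni} → r σ σ' →
                   αᵗ r (abstraction σ) (abstraction σ')
  αᵗ-abstraction r {σ} {σ'} rσσ' =
    σ , σ' , agree-abstraction σ , agree-abstraction σ' , rσσ'
      , CS-abstraction σ σ' , (λ _ → refl) , (λ _ → refl)

lemma5 : (nb ni n : ℕ) (φ : Fin n → Pred ni)
    (r : CState nb ni → CState nb ni → Set)
    (s : Abstraction.AState {nb} {ni} {n} φ → Set) →
    post r (Abstraction.γ φ s)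
    ⊆ Abstraction.γ φ (post (Abstraction.αᵗ φ r) s)
lemma5 nb ni n φ r s σ' (σ , σ∈γs , rσσ') =
  abstraction φ σ , σ∈γs , αᵗ-abstraction φ r rσσ'
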